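{- Let there be a derivation $\Phi$ in system $\mathcal{V}$ of $\Gamma\vdash^{(0,0,s)} t:\sigma$. If $\Phi$ is tight, then $s=|t|_v$.
   Context: Terms are $t,u,r ::= x \mid \lambda x.t \mid t\,u \mid t[x\backslash u]$ over a countably infinite set of variables, where $t[x\backslash u]$ (explicit substitution) binds $x$ in $t$; terms are taken modulo $\alpha$-conversion. The $v$-size is $|x|_v = 0$, $|\lambda x.t|_v=0$, $|t\,u|_v = |t|_v+|u|_v+1$, $|t[x\backslash u]|_v = |t|_v+|u|_v$. Types. Tight types: $\mathtt{tt} ::= \mathtt{n} \mid \mathtt{vl} \mid \mathtt{vr}$. Types $\sigma,\tau ::= \mathtt{tt}\mid\mathcal{M}\mid\mathcal{M}\to\sigma$, with multitypes $\mathcal{M}=[\sigma_i]_{i\in I}$ finite multisets of types ($[\,]$ empty, $\sqcup$ union). Typing contexts $\Gamma$ map variables to multitypes, $[\,]$ for all but finitely many; $(\Gamma+\Delta)(x)=\Gamma(x)\sqcup\Delta(x)$, extended to finite sums; $\Gamma\setminus\!\!\setminus x$ maps $x$ to $[\,]$ and agrees with $\Gamma$ elsewhere. Judgements $\Gamma\vdash^{(m,e,s)} t:\sigma$ carry integer counters. System $\mathcal{V}$ has the rules: (var$_p$) $x:[\mathtt{vr}]\vdash^{(0,0,0)} x:\mathtt{vr}$; (val$_p$) $\emptyset\vdash^{(0,0,0)} x:\mathtt{vl}$; (abs$_p$) $\emptyset\vdash^{(0,0,0)}\lambda x.t:\mathtt{vl}$; (app$_p$) from $\Gamma\vdash^{(m,e,s)}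 t:\mathtt{tt}_1$ with $\mathtt{tt}_1\in\{\mathtt{vr},\mathtt{n}\}$ and $\Delta\vdash^{(m',e',s')} u:\mathtt{tt}_2$ with $\mathtt{tt}_2\in\{\mathtt{vl},\mathtt{n}\}$, infer $\Gamma+\Delta\vdash^{(m+m',e+e',s+s'+1)} t\,u:\mathtt{n}$; (es$_p$) from $\Gamma\vdash^{(m,e,s)} t:\tau$, $\Delta\vdash^{(m',e',s')} u:\mathtt{n}$ and $\Gamma(x)$ tight, infer $(\Gamma\setminus\!\!\setminus x)+\Delta\vdash^{(m+m',e+e',s+s')} t[x\backslash u]:\tau$; (var$_c$) $x:\mathcal{M}\vdash^{(0,1,0)} x:\mathcal{M}$ for any multitype $\mathcal{M}$; (app$_c$) from $\Gamma\vdash^{(m,e,s)} t:[\mathcal{M}\to\tau]$ and $\Delta\vdash^{(m',e',s')} u:\mathcal{M}$, infer $\Gamma+\Delta\vdash^{(m+m'+1,e+e'-1,s+s')} t\,u:\tau$; (appt$_c$) from $\Gamma\vdash^{(m,e,s)} t:[\mathcal{M}\to\tau]$, $\Delta\vdash^{(m',e',s')} u:\mathtt{n}$ and $\mathcal{M}$ tight, infer $\Gamma+\Delta\vdash^{(m+m'+1,e+e'-1,s+s')} t\,u:\tau$; (abs$_c$) from $\Gamma_i\vdash^{(m_i,e_i,s_i)} t:\tau_i$ for each $i\in I$ ($I$ finite, possibly empty), infer $+_{i\in I}(\Gamma_i\setminus\!\!\setminus x)\vdash^{(\sum_i m_i,\,1+\sum_i e_i,\,\sum_i s_i)}\lambda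 x.t:[\Gamma_i(x)\to\tau_i]_{i\in I}$; (es$_c$) from $\Gamma\vdash^{(m,e,s)} t:\sigma$ and $\Delta\vdash^{(m',e',s')} u:\Gamma(x)$, infer $(\Gamma\setminus\!\!\setminus x)+\Delta\vdash^{(m+m',e+e',s+s')} t[x\backslash u]:\sigma$. A multitype is tight if all its elements are tight types; a context is tight if all its multitypes are tight; a derivation of $\Gamma\vdash^{(m,e,s)} t:\sigma$ is tight if $\Gamma$ is tight and $\sigma$ is a tight type. -}

module Defs where

open import Data.Nat using (ℕ; zero; suc)
open import Data.Integer using (ℤ; +_; _+_; _-_)
open import Data.List using (List; []; _∷_; _++_)
open import Data.List.Relation.Unary.All using (All)
open import Data.Product using (_×_)
open import Data.List.Relation.Binary.Permutation.Homogeneous using (Permutation)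

-- Terms in de Bruijn form (α-equivalence classes of terms).
-- Variables are indices; λ and explicit substitution bind index 0 in the body.
data Term : Set where
  var  : ℕ → Term
  lam  : Term → Term
  app  : Term → Term → Term
  esub : Term → Term → Term       -- esub t u  =  t[x\u], x = index 0 of t

vsize : Term → ℕ
vsize (var x)    = 0
vsize (lam t)    = 0
vsize (app t u)  = suc (vsize t Data.Nat.+ vsize u)
vsize (esub t u) = vsize t Data.Nat.+ vsize u

data TightTy : Set where
  n vl vr : TightTy

-- Types σ ::= tt | M | M → σ ;  multitypes are finite multisets (lists up to permutation)
data Type : Set where
  tt  : TightTy → Type
  mt  : List Type → Type
  _⇒_ : List Type → Type → Type

Multitype : Set
Multitype = List Type

data _≈_ : Type → Type → Set where
  tt-≈ : ∀ {a} → tt a ≈ tt a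
  mt-≈ : ∀ {M N} → Permutation _≈_ M N → mt M ≈ mt N
  ⇒-≈  : ∀ {M N σ τ} → Permutation _≈_ M N → σ ≈ τ → (M ⇒ σ) ≈ (N ⇒ τ)

_≈ₘ_ : Multitype → Multitype → Set
M ≈ₘ N = Permutation _≈_ M N

data IsTightTy : Type → Set where
  tight : ∀ a → IsTightTy (tt a)

TightMT : Multitype → Set
TightMT M = All IsTightTy M

Ctx : Set
Ctx = ℕ → Multitype

∅ : Ctx
∅ _ = []

_∶ₓ_ : ℕ → Multitype → Ctx
(zero  ∶ₓ M) zero    = M
(zero  ∶ₓ M) (suc _) = []
(suc x ∶ₓ M) zero    = []
(suc x ∶ₓ M) (suc y) = (x ∶ₓ M) y

_⊕_ : Ctx → Ctx → Ctx
(Γ ⊕ Δ) x = Γ x ++ Δ x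

-- Γ \\ x for the bound variable (index 0), re-indexed for the outer scope
drop0 : Ctx → Ctx
drop0 Γ x = Γ (suc x)

TightCtx : Ctx → Set
TightCtx Γ = ∀ x → TightMT (Γ x)

data VrOrN : TightTy → Set where
  is-vr : VrOrN vr
  is-n  : VrOrN n

data VlOrN : TightTy → Set where
  is-vl : VlOrN vl
  is-n  : VlOrN n

mutual
  data _⊢[_,_,_]_∶_ : Ctx → ℤ → ℤ → ℤ → Term → Type → Set where
    var-p : ∀ {x} → (x ∶ₓ (tt vr ∷ [])) ⊢[ + 0 , + 0 , + 0 ] var x ∶ tt vr
    val-p : ∀ {x} → ∅ ⊢[ + 0 , + 0 , + 0 ] var x ∶ tt vl
    abs-p : ∀ {t} → ∅ ⊢[ + 0 , + 0 , + 0 ] lam t ∶ tt vl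
    app-p : ∀ {Γ Δ m e s m' e' s' t u a b} →
            Γ ⊢[ m , e , s ] t ∶ tt a → VrOrN a →
            Δ ⊢[ m' , e' , s' ] u ∶ tt b → VlOrN b →
            (Γ ⊕ Δ) ⊢[ m + m' , e + e' , (s + s') + + 1 ] app t u ∶ tt n
    es-p  : ∀ {Γ Δ m e s m' e' s' t u τ} →
            Γ ⊢[ m , e , s ] t ∶ τ →
            Δ ⊢[ m' , e' , s' ] u ∶ tt n →
            TightMT (Γ 0) →
            (drop0 Γ ⊕ Δ) ⊢[ m + m' , e + e' , s + s' ] esub t u ∶ τ
    var-c : ∀ {x M} → (x ∶ₓ M) ⊢[ + 0 , + 1 , + 0 ] var x ∶ mt M
    app-c : ∀ {Γ Δ m e s m' e' s' t u M M' τ} →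
            Γ ⊢[ m , e , s ] t ∶ mt ((M ⇒ τ) ∷ []) →
            Δ ⊢[ m' , e' , s' ] u ∶ mt M' → M ≈ₘ M' →
            (Γ ⊕ Δ) ⊢[ (m + m') + + 1 , (e + e') - + 1 , s + s' ] app t u ∶ τ
    appt-c : ∀ {Γ Δ m e s m' e' s' t u M τ} →
            Γ ⊢[ m , e , s ] t ∶ mt ((M ⇒ τ) ∷ []) →
            Δ ⊢[ m' , e' , s' ] u ∶ tt n → TightMT M →
            (Γ ⊕ Δ) ⊢[ (m + m') + + 1 , (e + e') - + 1 , s + s' ] app t u ∶ τ
    abs-c : ∀ {Γ M m e s t} →
            AbsFam t Γ M m e s →
            Γ ⊢[ m , + 1 + e , s ] lam t ∶ mt M
    es-c  : ∀ {Γ Δ m e s m' e' s' t u σ M} →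
            Γ ⊢[ m , e , s ] t ∶ σ →
            Δ ⊢[ m' , e' , s' ] u ∶ mt M → M ≈ₘ Γ 0 →
            (drop0 Γ ⊕ Δ) ⊢[ m + m' , e + e' , s + s' ] esub t u ∶ σ

  -- A finite family (indexed by I, possibly empty) of premises for abs-c:
  -- AbsFam t Γ M m e s  collects  Γ_i ⊢ t : τ_i  with
  -- Γ = +_i (Γ_i \\ x),  M = [Γ_i(x) → τ_i]_i,  m = Σ m_i, e = Σ e_i, s = Σ s_i.
  data AbsFam (t : Term) : Ctx → Multitype → ℤ → ℤ → ℤ → Set where
    fam-[] : AbsFam t ∅ [] (+ 0) (+ 0) (+ 0)
    fam-∷  : ∀ {Γᵢ τᵢ mᵢ eᵢ sᵢ Γ M m e s} →
             Γᵢ ⊢[ mᵢ , eᵢ , sᵢ ] t ∶ τᵢ →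
             AbsFam t Γ M m e s →
             AbsFam t (drop0 Γᵢ ⊕ Γ) ((Γᵢ 0 ⇒ τᵢ) ∷ M) (mᵢ + m) (eᵢ + e) (sᵢ + s)

TightJudgement : Ctx → Type → Set
TightJudgement Γ σ = TightCtx Γ × IsTightTy σ

-- Call m + e the weight of a derivation. It is never negative: var_c and abs_c add 1
-- to it and no rule decreases it (the -1 on e in app_c/appt_c cancels their +1 on m).
-- A consuming rule can thus conclude with weight zero only if its premises do, but
-- app_c, appt_c and es_c each have a premise typed by a multitype, whereas a weightless
-- derivation has a tight type. So a derivation with m = e = 0 uses persistent rules only,
-- and these count in s exactly the applications of t.
module Submission where

open import Defs
open import Data.Integer using (ℤ; +_; _+_; _-_; _≤_; +≤+)
open import Data.Integer.Properties using (≤-refl; +-mono-≤; +-injective)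
open import Data.Integer.Tactic.RingSolver using (solve-∀)
import Data.Nat as ℕ
open import Data.Nat using (z≤n)
open import Data.Nat.Properties using (+-comm; m+n≡0⇒m≡0; m+n≡0⇒n≡0)
open import Data.Product using (_×_; _,_; proj₁; proj₂)
open import Data.Empty using (⊥-elim)
open import Relation.Nullary using (¬_)
open import Relation.Binary.PropositionalEquality using (_≡_; _≢_; refl; sym; trans; cong)

+-interchange : ∀ m m' e e' → (m + m') + (e + e') ≡ (m + e) + (m' + e')
+-interchange = solve-∀

app-c-weight : ∀ m m' e e' → ((m + m') + + 1) + ((e + e') - + 1) ≡ (m + e) + (m' + e')
app-c-weight = solve-∀

abs-c-weight : ∀ m e → m + (+ 1 + e) ≡ + 1 + (m + e)
abs-c-weight = solve-∀

nonneg-resp-≡ : ∀ {a b} → a ≡ b → + 0 ≤ b → + 0 ≤ a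
nonneg-resp-≡ refl p = p

nonneg-+≡0⇒≡0 : ∀ {a b} → + 0 ≤ a → + 0 ≤ b → a + b ≡ + 0 → a ≡ + 0 × b ≡ + 0
nonneg-+≡0⇒≡0 (+≤+ {n = k} z≤n) (+≤+ z≤n) eq =
  cong +_ (m+n≡0⇒m≡0 k (+-injective eq)) , cong +_ (m+n≡0⇒n≡0 k (+-injective eq))

1+nonneg≢0 : ∀ {a} → + 0 ≤ a → + 1 + a ≢ + 0
1+nonneg≢0 (+≤+ z≤n) ()

¬tight-mt : ∀ {M} → ¬ IsTightTy (mt M)
¬tight-mt ()

mutual
  weight-nonneg : ∀ {Γ m e s t σ} → Γ ⊢[ m , e , s ] t ∶ σ → + 0 ≤ m + e
  weight-nonneg var-p = ≤-refl
  weight-nonneg val-p = ≤-refl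
  weight-nonneg abs-p = ≤-refl
  weight-nonneg var-c = +≤+ z≤n
  weight-nonneg (app-p d _ d' _) = binary-weight-nonneg d d'
  weight-nonneg (es-p d d' _)    = binary-weight-nonneg d d'
  weight-nonneg (es-c d d' _)    = binary-weight-nonneg d d'
  weight-nonneg (app-c {m = m} {e} {_} {m'} {e'} d d' _) =
    nonneg-resp-≡ (app-c-weight m m' e e') (+-mono-≤ (weight-nonneg d) (weight-nonneg d'))
  weight-nonneg (appt-c {m = m} {e} {_} {m'} {e'} d d' _) =
    nonneg-resp-≡ (app-c-weight m m' e e') (+-mono-≤ (weight-nonneg d) (weight-nonneg d'))
  weight-nonneg (abs-c {m = m} {e} f) =
    nonneg-resp-≡ (abs-c-weight m e) (+-mono-≤ (+≤+ z≤n) (family-weight-nonneg f))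

  family-weight-nonneg : ∀ {t Γ M m e s} → AbsFam t Γ M m e s → + 0 ≤ m + e
  family-weight-nonneg fam-[] = ≤-refl
  family-weight-nonneg (fam-∷ {mᵢ = mᵢ} {eᵢ} {m = m} {e} d f) =
    nonneg-resp-≡ (+-interchange mᵢ m eᵢ e) (+-mono-≤ (weight-nonneg d) (family-weight-nonneg f))

  binary-weight-nonneg : ∀ {Γ Δ m e s m' e' s' t u σ τ} →
    Γ ⊢[ m , e , s ] t ∶ σ → Δ ⊢[ m' , e' , s' ] u ∶ τ → + 0 ≤ (m + m') + (e + e')
  binary-weight-nonneg {m = m} {e} {_} {m'} {e'} d d' =
    nonneg-resp-≡ (+-interchange m m' e e') (+-mono-≤ (weight-nonneg d) (weight-nonneg d'))

weightless-premises : ∀ {Γ Δ m e s m' e' s' t u σ τ} →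
  Γ ⊢[ m , e , s ] t ∶ σ → Δ ⊢[ m' , e' , s' ] u ∶ τ →
  (m + e) + (m' + e') ≡ + 0 → m + e ≡ + 0 × m' + e' ≡ + 0
weightless-premises d d' = nonneg-+≡0⇒≡0 (weight-nonneg d) (weight-nonneg d')

weightless⇒tight∧s≡vsize : ∀ {Γ m e s t σ} → Γ ⊢[ m , e , s ] t ∶ σ →
  m + e ≡ + 0 → IsTightTy σ × s ≡ + vsize t
weightless⇒tight∧s≡vsize var-p _ = tight vr , refl
weightless⇒tight∧s≡vsize val-p _ = tight vl , refl
weightless⇒tight∧s≡vsize abs-p _ = tight vl , refl
weightless⇒tight∧s≡vsize var-c ()
weightless⇒tight∧s≡vsize (app-p {m = m} {e} {_} {m'} {e'} {t = t} {u} d _ d' _) w≡0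
  with weightless-premises d d' (trans (sym (+-interchange m m' e e')) w≡0)
... | w₁ , w₂ with weightless⇒tight∧s≡vsize d w₁ | weightless⇒tight∧s≡vsize d' w₂
... | _ , refl | _ , refl = tight n , cong +_ (+-comm (vsize t ℕ.+ vsize u) 1)
weightless⇒tight∧s≡vsize (es-p {m = m} {e} {_} {m'} {e'} d d' _) w≡0
  with weightless-premises d d' (trans (sym (+-interchange m m' e e')) w≡0)
... | w₁ , w₂ with weightless⇒tight∧s≡vsize d w₁ | weightless⇒tight∧s≡vsize d' w₂
... | σ-tight , refl | _ , refl = σ-tight , refl
weightless⇒tight∧s≡vsize (app-c {m = m} {e} {_} {m'} {e'} d d' _) w≡0
  with weightless-premises d d' (trans (sym (app-c-weight m m' e e')) w≡0)
... | w₁ , _ = ⊥-elim (¬tight-mt (proj₁ (weightless⇒tight∧s≡vsize d w₁)))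
weightless⇒tight∧s≡vsize (appt-c {m = m} {e} {_} {m'} {e'} d d' _) w≡0
  with weightless-premises d d' (trans (sym (app-c-weight m m' e e')) w≡0)
... | w₁ , _ = ⊥-elim (¬tight-mt (proj₁ (weightless⇒tight∧s≡vsize d w₁)))
weightless⇒tight∧s≡vsize (es-c {m = m} {e} {_} {m'} {e'} d d' _) w≡0
  with weightless-premises d d' (trans (sym (+-interchange m m' e e')) w≡0)
... | _ , w₂ = ⊥-elim (¬tight-mt (proj₁ (weightless⇒tight∧s≡vsize d' w₂)))
weightless⇒tight∧s≡vsize (abs-c {m = m} {e} f) w≡0 =
  ⊥-elim (1+nonneg≢0 (family-weight-nonneg f) (trans (sym (abs-c-weight m e)) w≡0))

lemma4p4 : ∀ {Γ : Ctx} {t : Term} {σ : Type} {s : ℤ} →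
    (Φ : Γ ⊢[ + 0 , + 0 , s ] t ∶ σ) →
    TightJudgement Γ σ →
    s ≡ + vsize t
lemma4p4 Φ _ = proj₂ (weightless⇒tight∧s≡vsize Φ refl)
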